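{- $\mathsf{RCA}_0^3$ proves each of the following statements: (1) For each type-2 functional $F$, there is a real $r$ such that $\forall s^1, n^0[\forall k^0(s(k)=n)\implies r(n)=F(s)]$. (2) For each type-2 functional $F$, there is a type-2 functional $G$ such that $G(\langle a_0, a_1, a_2, \dots , a_n, \dots \rangle)=F(\langle a_{0}, a_2, a_4, \dots , a_{2n}, \dots \rangle)$.
   Context: $\mathsf{RCA}_0^3$ is the theory in the three-sorted language $L^3$ with sorts for naturals (type 0), reals $\omega\to\omega$ (type 1) and functionals from reals to naturals (type 2), the arithmetic signature on type 0, application operators, an operation $^\frown\colon s_0\times s_1\to s_1$ and an operation $*\colon s_2\times s_1\to s_1$. Its axioms: $P^-$ and $\Sigma^0_1$-induction for type 0; extensionality for types 1 and 2; $\Delta^0_1$-comprehension for type 1 and type 2 (if $\varphi\in\Sigma^0_1$, with arbitrary parameters, and $\forall x\exists!y^0\varphi(x,y)$ with $x$ of type 0 resp. 1, then there is an object $f$ of type 1 resp. 2 with $\forall x\,\varphi(x,f(x))$; $\Sigma^0_0$ formulas have only bounded type-0 quantifiers and no $=_1,=_2$); and $(k^\frown r)(0)=k$, $(k^\frown r)(n+1)=r(n)$, $(F*r)(k)=F(k^\frown r)$. -}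

module Defs where

-- A deep embedding of the three-sorted theory RCA₀³ (language L³, its
-- axioms, and a classical natural-deduction proof system), so that
-- "RCA₀³ proves φ" can be stated as the inhabitation of Proves φ.

open import Data.List using (List; []; _∷_; map)
open import Data.List.Membership.Propositional using (_∈_)

-- Sorts: type 0 (naturals), type 1 (reals ω→ω), type 2 (functionals)

data Sort : Set where
  s0 s1 s2 : Sort

Ctx : Set
Ctx = List Sort

data _∋_ : Ctx → Sort → Set where
  here  : ∀ {Γ σ} → (σ ∷ Γ) ∋ σ
  there : ∀ {Γ σ τ} → Γ ∋ σ → (τ ∷ Γ) ∋ σ

infixl 6 _⊕_
infixl 7 _⊗_

data Tm (Γ : Ctx) : Sort → Set where
  var  : ∀ {σ} → Γ ∋ σ → Tm Γ σ
  zer  : Tm Γ s0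
  one  : Tm Γ s0
  _⊕_  : Tm Γ s0 → Tm Γ s0 → Tm Γ s0
  _⊗_  : Tm Γ s0 → Tm Γ s0 → Tm Γ s0
  ap1  : Tm Γ s1 → Tm Γ s0 → Tm Γ s0
  ap2  : Tm Γ s2 → Tm Γ s1 → Tm Γ s0
  cons : Tm Γ s0 → Tm Γ s1 → Tm Γ s1
  star : Tm Γ s2 → Tm Γ s1 → Tm Γ s1

infixr 4 _⇒_
infixr 5 _∨_
infixr 6 _∧_

data Fm (Γ : Ctx) : Set where
  eq   : (σ : Sort) → Tm Γ σ → Tm Γ σ → Fm Γ
  lt   : Tm Γ s0 → Tm Γ s0 → Fm Γ
  bot  : Fm Γ
  _∧_  : Fm Γ → Fm Γ → Fm Γ
  _∨_  : Fm Γ → Fm Γ → Fm Γ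
  _⇒_  : Fm Γ → Fm Γ → Fm Γ
  all  : (σ : Sort) → Fm (σ ∷ Γ) → Fm Γ
  ex   : (σ : Sort) → Fm (σ ∷ Γ) → Fm Γ

Ren : Ctx → Ctx → Set
Ren Γ Δ = ∀ {σ} → Γ ∋ σ → Δ ∋ σ

liftR : ∀ {Γ Δ τ} → Ren Γ Δ → Ren (τ ∷ Γ) (τ ∷ Δ)
liftR ρ here      = here
liftR ρ (there v) = there (ρ v)

renT : ∀ {Γ Δ σ} → Ren Γ Δ → Tm Γ σ → Tm Δ σ
renT ρ (var v)    = var (ρ v)
renT ρ zer        = zer
renT ρ one        = one
renT ρ (s ⊕ t)    = renT ρ s ⊕ renT ρ t
renT ρ (s ⊗ t)    = renT ρ s ⊗ renT ρ t
renT ρ (ap1 r n)  = ap1 (renT ρ r) (renT ρ n)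
renT ρ (ap2 f r)  = ap2 (renT ρ f) (renT ρ r)
renT ρ (cons k r) = cons (renT ρ k) (renT ρ r)
renT ρ (star f r) = star (renT ρ f) (renT ρ r)

renF : ∀ {Γ Δ} → Ren Γ Δ → Fm Γ → Fm Δ
renF ρ (eq σ s t) = eq σ (renT ρ s) (renT ρ t)
renF ρ (lt s t)   = lt (renT ρ s) (renT ρ t)
renF ρ bot        = bot
renF ρ (φ ∧ ψ)    = renF ρ φ ∧ renF ρ ψ
renF ρ (φ ∨ ψ)    = renF ρ φ ∨ renF ρ ψ
renF ρ (φ ⇒ ψ)    = renF ρ φ ⇒ renF ρ ψ
renF ρ (all σ φ)  = all σ (renF (liftR ρ) φ)
renF ρ (ex σ φ)   = ex σ (renF (liftR ρ) φ)

wkT : ∀ {Γ σ τ} → Tm Γ σ → Tm (τ ∷ Γ) σ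
wkT = renT there

wkF : ∀ {Γ τ} → Fm Γ → Fm (τ ∷ Γ)
wkF = renF there

Sub : Ctx → Ctx → Set
Sub Γ Δ = ∀ {σ} → Γ ∋ σ → Tm Δ σ

liftS : ∀ {Γ Δ τ} → Sub Γ Δ → Sub (τ ∷ Γ) (τ ∷ Δ)
liftS θ here      = var here
liftS θ (there v) = wkT (θ v)

subT : ∀ {Γ Δ σ} → Sub Γ Δ → Tm Γ σ → Tm Δ σ
subT θ (var v)    = θ v
subT θ zer        = zer
subT θ one        = one
subT θ (s ⊕ t)    = subT θ s ⊕ subT θ t
subT θ (s ⊗ t)    = subT θ s ⊗ subT θ t
subT θ (ap1 r n)  = ap1 (subT θ r) (subT θ n)
subT θ (ap2 f r)  = ap2 (subT θ f) (subT θ r)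
subT θ (cons k r) = cons (subT θ k) (subT θ r)
subT θ (star f r) = star (subT θ f) (subT θ r)

subF : ∀ {Γ Δ} → Sub Γ Δ → Fm Γ → Fm Δ
subF θ (eq σ s t) = eq σ (subT θ s) (subT θ t)
subF θ (lt s t)   = lt (subT θ s) (subT θ t)
subF θ bot        = bot
subF θ (φ ∧ ψ)    = subF θ φ ∧ subF θ ψ
subF θ (φ ∨ ψ)    = subF θ φ ∨ subF θ ψ
subF θ (φ ⇒ ψ)    = subF θ φ ⇒ subF θ ψ
subF θ (all σ φ)  = all σ (subF (liftS θ) φ)
subF θ (ex σ φ)   = ex σ (subF (liftS θ) φ)

single : ∀ {Γ σ} → Tm Γ σ → Sub (σ ∷ Γ) Γ
single t here      = t
single t (there v) = var v

_[_] : ∀ {Γ σ} → Fm (σ ∷ Γ) → Tm Γ σ → Fm Γ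
φ [ t ] = subF (single t) φ

replTop : ∀ {Γ σ} → Tm (σ ∷ Γ) σ → Sub (σ ∷ Γ) (σ ∷ Γ)
replTop t here      = t
replTop t (there v) = var (there v)

v0 : ∀ {Γ σ} → Tm (σ ∷ Γ) σ
v0 = var here
v1 : ∀ {Γ σ τ} → Tm (τ ∷ σ ∷ Γ) σ
v1 = var (there here)
v2 : ∀ {Γ σ τ₁ τ₂} → Tm (τ₂ ∷ τ₁ ∷ σ ∷ Γ) σ
v2 = var (there (there here))
v3 : ∀ {Γ σ τ₁ τ₂ τ₃} → Tm (τ₃ ∷ τ₂ ∷ τ₁ ∷ σ ∷ Γ) σ
v3 = var (there (there (there here)))

data IsΣ00 {Γ : Ctx} : Fm Γ → Set where
  σ-eq  : ∀ s t → IsΣ00 (eq s0 s t)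
  σ-lt  : ∀ s t → IsΣ00 (lt s t)
  σ-bot : IsΣ00 bot
  σ-∧   : ∀ {φ ψ} → IsΣ00 φ → IsΣ00 ψ → IsΣ00 (φ ∧ ψ)
  σ-∨   : ∀ {φ ψ} → IsΣ00 φ → IsΣ00 ψ → IsΣ00 (φ ∨ ψ)
  σ-⇒   : ∀ {φ ψ} → IsΣ00 φ → IsΣ00 ψ → IsΣ00 (φ ⇒ ψ)
  σ-ball : ∀ (t : Tm Γ s0) {φ : Fm (s0 ∷ Γ)} → IsΣ00 φ →
           IsΣ00 (all s0 (lt v0 (wkT t) ⇒ φ))
  σ-bex  : ∀ (t : Tm Γ s0) {φ : Fm (s0 ∷ Γ)} → IsΣ00 φ →
           IsΣ00 (ex s0 (lt v0 (wkT t) ∧ φ))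

data IsΣ01 {Γ : Ctx} : Fm Γ → Set where
  σ-ex : ∀ {θ : Fm (s0 ∷ Γ)} → IsΣ00 θ → IsΣ01 (ex s0 θ)

ex!0 : ∀ {Γ} → Fm (s0 ∷ Γ) → Fm Γ
ex!0 φ = ex s0 (φ ∧ all s0 (renF (liftR there) φ ⇒ eq s0 v0 v1))

-- substitution used by comprehension: in φ(x,y) (context y ∷ x ∷ Γ),
-- put y := f(x) with f the new function variable (context x ∷ f ∷ Γ).
compSub : ∀ {Γ σ τ} → Tm (σ ∷ τ ∷ Γ) s0 → Sub (s0 ∷ σ ∷ Γ) (σ ∷ τ ∷ Γ)
compSub fx here              = fx
compSub fx (there here)      = v0
compSub fx (there (there v)) = var (there (there v))

-- Axioms of RCA₀³ (schematic; free variables act as parameters)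

infix 8 _≤'_
_≤'_ : ∀ {Γ} → Tm Γ s0 → Tm Γ s0 → Fm Γ
s ≤' t = lt s t ∨ eq s0 s t

data Axiom {Γ : Ctx} : Fm Γ → Set where
  -- P⁻ (axioms of the nonnegative part of a discretely ordered ring)
  p-+comm  : ∀ x y → Axiom (eq s0 (x ⊕ y) (y ⊕ x))
  p-+assoc : ∀ x y z → Axiom (eq s0 ((x ⊕ y) ⊕ z) (x ⊕ (y ⊕ z)))
  p-·comm  : ∀ x y → Axiom (eq s0 (x ⊗ y) (y ⊗ x))
  p-·assoc : ∀ x y z → Axiom (eq s0 ((x ⊗ y) ⊗ z) (x ⊗ (y ⊗ z)))
  p-distr  : ∀ x y z → Axiom (eq s0 (x ⊗ (y ⊕ z)) ((x ⊗ y) ⊕ (x ⊗ z)))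
  p-+0     : ∀ x → Axiom (eq s0 (x ⊕ zer) x)
  p-·0     : ∀ x → Axiom (eq s0 (x ⊗ zer) zer)
  p-·1     : ∀ x → Axiom (eq s0 (x ⊗ one) x)
  p-irr    : ∀ x → Axiom (lt x x ⇒ bot)
  p-trans  : ∀ x y z → Axiom (lt x y ∧ lt y z ⇒ lt x z)
  p-total  : ∀ x y → Axiom (lt x y ∨ eq s0 x y ∨ lt y x)
  p-+mono  : ∀ x y z → Axiom (lt x y ⇒ lt (x ⊕ z) (y ⊕ z))
  p-·mono  : ∀ x y z → Axiom (lt zer z ∧ lt x y ⇒ lt (x ⊗ z) (y ⊗ z))
  p-sub    : ∀ x y → Axiom (lt x y ⇒ ex s0 (eq s0 (wkT x ⊕ v0) (wkT y)))
  p-01     : Axiom (lt zer one)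
  p-disc   : ∀ x → Axiom (lt zer x ⇒ one ≤' x)
  p-nonneg : ∀ x → Axiom (zer ≤' x)
  ind : ∀ (φ : Fm (s0 ∷ Γ)) → IsΣ01 φ →
        Axiom ((φ [ zer ] ∧ all s0 (φ ⇒ subF (replTop (v0 ⊕ one)) φ))
               ⇒ all s0 φ)
  ext1 : ∀ (f g : Tm Γ s1) →
         Axiom (all s0 (eq s0 (ap1 (wkT f) v0) (ap1 (wkT g) v0)) ⇒ eq s1 f g)
  ext2 : ∀ (f g : Tm Γ s2) →
         Axiom (all s1 (eq s0 (ap2 (wkT f) v0) (ap2 (wkT g) v0)) ⇒ eq s2 f g)
  -- Δ⁰₁-comprehension for type 1 (x of type 0) and type 2 (x of type 1);
  -- φ(x,y) lives in context y ∷ x ∷ Γ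
  comp1 : ∀ (φ : Fm (s0 ∷ s0 ∷ Γ)) → IsΣ01 φ →
          Axiom (all s0 (ex!0 φ)
                 ⇒ ex s1 (all s0 (subF (compSub (ap1 v1 v0)) φ)))
  comp2 : ∀ (φ : Fm (s0 ∷ s1 ∷ Γ)) → IsΣ01 φ →
          Axiom (all s1 (ex!0 φ)
                 ⇒ ex s2 (all s1 (subF (compSub (ap2 v1 v0)) φ)))
  cons-0   : ∀ k r → Axiom (eq s0 (ap1 (cons k r) zer) k)
  cons-suc : ∀ k r n → Axiom (eq s0 (ap1 (cons k r) (n ⊕ one)) (ap1 r n))
  star-def : ∀ F r k → Axiom (eq s0 (ap1 (star F r) k) (ap2 F (cons k r)))

data Pf {Γ : Ctx} (Hs : List (Fm Γ)) : Fm Γ → Set where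
  hyp   : ∀ {φ} → φ ∈ Hs → Pf Hs φ
  ax    : ∀ {φ} → Axiom φ → Pf Hs φ
  ∧I    : ∀ {φ ψ} → Pf Hs φ → Pf Hs ψ → Pf Hs (φ ∧ ψ)
  ∧E₁   : ∀ {φ ψ} → Pf Hs (φ ∧ ψ) → Pf Hs φ
  ∧E₂   : ∀ {φ ψ} → Pf Hs (φ ∧ ψ) → Pf Hs ψ
  ∨I₁   : ∀ {φ ψ} → Pf Hs φ → Pf Hs (φ ∨ ψ)
  ∨I₂   : ∀ {φ ψ} → Pf Hs ψ → Pf Hs (φ ∨ ψ)
  ∨E    : ∀ {φ ψ χ} → Pf Hs (φ ∨ ψ) → Pf (φ ∷ Hs) χ → Pf (ψ ∷ Hs) χ → Pf Hs χ
  ⇒I    : ∀ {φ ψ} → Pf (φ ∷ Hs) ψ → Pf Hs (φ ⇒ ψ)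
  ⇒E    : ∀ {φ ψ} → Pf Hs (φ ⇒ ψ) → Pf Hs φ → Pf Hs ψ
  raa   : ∀ {φ} → Pf ((φ ⇒ bot) ∷ Hs) bot → Pf Hs φ
  ∀I    : ∀ {σ φ} → Pf {σ ∷ Γ} (map wkF Hs) φ → Pf Hs (all σ φ)
  ∀E    : ∀ {σ φ} → Pf Hs (all σ φ) → (t : Tm Γ σ) → Pf Hs (φ [ t ])
  ∃I    : ∀ {σ φ} (t : Tm Γ σ) → Pf Hs (φ [ t ]) → Pf Hs (ex σ φ)
  ∃E    : ∀ {σ φ ψ} → Pf Hs (ex σ φ) → Pf {σ ∷ Γ} (φ ∷ map wkF Hs) (wkF ψ) →
          Pf Hs ψ
  ≡refl : ∀ {σ} (t : Tm Γ σ) → Pf Hs (eq σ t t)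
  ≡subst : ∀ {σ} (φ : Fm (σ ∷ Γ)) {s t : Tm Γ σ} →
           Pf Hs (eq σ s t) → Pf Hs (φ [ s ]) → Pf Hs (φ [ t ])

RCA03⊢ : Fm [] → Set
RCA03⊢ φ = Pf {[]} [] φ

-- (1) ∀F² ∃r¹ ∀s¹ ∀n⁰ [ ∀k⁰ (s(k) = n) → r(n) = F(s) ]
-- contexts: F ; r F ; s r F ; n s r F ; k n s r F
stmt1 : Fm []
stmt1 =
  all s2 (ex s1 (all s1 (all s0
    (all s0 (eq s0 (ap1 v2 v0) v1) ⇒ eq s0 (ap1 v2 v0) (ap2 v3 v1)))))

-- (2) ∀F² ∃G² ∀s¹ ∀t¹ [ ∀n⁰ (t(n) = s(2·n)) → G(s) = F(t) ],
-- i.e. G(⟨a₀,a₁,a₂,…⟩) = F(⟨a₀,a₂,a₄,…⟩)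
-- contexts: F ; G F ; s G F ; t s G F ; n t s G F
two : ∀ {Γ} → Tm Γ s0
two = one ⊕ one

stmt2 : Fm []
stmt2 =
  all s2 (ex s2 (all s1 (all s1
    (all s0 (eq s0 (ap1 v1 v0) (ap1 v2 (two ⊗ v0))) ⇒ eq s0 (ap2 v2 v1) (ap2 v3 v0)))))

module Submission where

-- Both statements are instances of one principle: RCA₀³ proves that every
-- term t(x) in a type-0 (resp. type-1) variable x defines a real (resp. a
-- type-2 functional) f with ∀x f(x) = t(x).  This "explicit definition"
-- principle follows from Δ⁰₁-comprehension applied to the graph y = t(x),
-- padded by a vacuous type-0 quantifier so that it is Σ⁰₁.

open import Defs
open import Data.Product using (_×_; _,_)
open import Data.List using (List; _∷_)
open import Data.List.Relation.Unary.Any using (here; there)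
open import Relation.Binary.PropositionalEquality
  using (_≡_; refl; sym; trans; cong₂; module ≡-Reasoning)

-- Substitution on terms.  Terms have no binders, so a substitution acts
-- variable by variable and composites are determined by their action on
-- variables.

sub-ren : ∀ {Γ Δ Θ σ} {θ : Sub Δ Θ} {ρ : Ren Γ Δ} (θ' : Sub Γ Θ) →
          (∀ {τ} (v : Γ ∋ τ) → θ (ρ v) ≡ θ' v) →
          (t : Tm Γ σ) → subT θ (renT ρ t) ≡ subT θ' t
sub-ren θ' p (var v)    = p v
sub-ren θ' p zer        = refl
sub-ren θ' p one        = refl
sub-ren θ' p (a ⊕ b)    = cong₂ _⊕_ (sub-ren θ' p a) (sub-ren θ' p b)
sub-ren θ' p (a ⊗ b)    = cong₂ _⊗_ (sub-ren θ' p a) (sub-ren θ' p b)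
sub-ren θ' p (ap1 a b)  = cong₂ ap1 (sub-ren θ' p a) (sub-ren θ' p b)
sub-ren θ' p (ap2 a b)  = cong₂ ap2 (sub-ren θ' p a) (sub-ren θ' p b)
sub-ren θ' p (cons a b) = cong₂ cons (sub-ren θ' p a) (sub-ren θ' p b)
sub-ren θ' p (star a b) = cong₂ star (sub-ren θ' p a) (sub-ren θ' p b)

sub-id : ∀ {Γ σ} {θ : Sub Γ Γ} → (∀ {τ} (v : Γ ∋ τ) → θ v ≡ var v) →
         (t : Tm Γ σ) → subT θ t ≡ t
sub-id p (var v)    = p v
sub-id p zer        = refl
sub-id p one        = refl
sub-id p (a ⊕ b)    = cong₂ _⊕_ (sub-id p a) (sub-id p b)
sub-id p (a ⊗ b)    = cong₂ _⊗_ (sub-id p a) (sub-id p b)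
sub-id p (ap1 a b)  = cong₂ ap1 (sub-id p a) (sub-id p b)
sub-id p (ap2 a b)  = cong₂ ap2 (sub-id p a) (sub-id p b)
sub-id p (cons a b) = cong₂ cons (sub-id p a) (sub-id p b)
sub-id p (star a b) = cong₂ star (sub-id p a) (sub-id p b)

ren-as-sub : ∀ {Γ Δ σ} (ρ : Ren Γ Δ) (t : Tm Γ σ) →
             renT ρ t ≡ subT (λ v → var (ρ v)) t
ren-as-sub ρ t = trans (sym (sub-id (λ _ → refl) (renT ρ t))) (sub-ren _ (λ _ → refl) t)

sub-single-wk : ∀ {Γ σ τ} (s : Tm Γ σ) (t : Tm Γ τ) → subT (single s) (wkT t) ≡ t
sub-single-wk s t = trans (sub-ren var (λ _ → refl) t) (sub-id (λ _ → refl) t)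

subst-Pf : ∀ {Γ} {A : Set} {Hs : List (Fm Γ)} (F : A → Fm Γ) {a b : A} →
           a ≡ b → Pf Hs (F a) → Pf Hs (F b)
subst-Pf F refl p = p

subst₂-Pf : ∀ {Γ} {A B : Set} {Hs : List (Fm Γ)} (F : A → B → Fm Γ) {a a' : A} {b b' : B} →
            a ≡ a' → b ≡ b' → Pf Hs (F a b) → Pf Hs (F a' b')
subst₂-Pf F refl refl p = p

module _ {Γ : Ctx} {Hs : List (Fm Γ)} where

  eq-cong : ∀ {σ τ} (u : Tm (σ ∷ Γ) τ) {a b : Tm Γ σ} →
            Pf Hs (eq σ a b) → Pf Hs (eq τ (subT (single a) u) (subT (single b) u))
  eq-cong {τ = τ} u {a} {b} p =
    subst-Pf (λ x → eq τ x (subT (single b) u)) (sub-single-wk b ua)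
      (≡subst (eq τ (wkT ua) u) p
        (subst-Pf (λ x → eq τ x ua) (sym (sub-single-wk a ua)) (≡refl ua)))
    where ua = subT (single a) u

  eq-sym : ∀ {σ} {a b : Tm Γ σ} → Pf Hs (eq σ a b) → Pf Hs (eq σ b a)
  eq-sym {σ} {a} {b} p =
    subst-Pf (eq σ b) (sub-single-wk b a)
      (≡subst (eq σ v0 (wkT a)) p
        (subst-Pf (eq σ a) (sym (sub-single-wk a a)) (≡refl a)))

  eq-trans : ∀ {σ} {a b c : Tm Γ σ} → Pf Hs (eq σ a b) → Pf Hs (eq σ b c) → Pf Hs (eq σ a c)
  eq-trans {σ} {a} {b} {c} p q =
    subst-Pf (λ x → eq σ x c) (sub-single-wk c a)
      (≡subst (eq σ (wkT a) v0) q
        (subst-Pf (λ x → eq σ x b) (sym (sub-single-wk b a)) p))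

  ap1-cong : (f : Tm Γ s1) {a b : Tm Γ s0} →
             Pf Hs (eq s0 a b) → Pf Hs (eq s0 (ap1 f a) (ap1 f b))
  ap1-cong f {a} {b} p =
    subst₂-Pf (λ x y → eq s0 (ap1 x a) (ap1 y b))
      (sub-single-wk a f) (sub-single-wk b f) (eq-cong (ap1 (wkT f) v0) p)

  ap2-cong : (F : Tm Γ s2) {a b : Tm Γ s1} →
             Pf Hs (eq s1 a b) → Pf Hs (eq s0 (ap2 F a) (ap2 F b))
  ap2-cong F {a} {b} p =
    subst₂-Pf (λ x y → eq s0 (ap2 x a) (ap2 y b))
      (sub-single-wk a F) (sub-single-wk b F) (eq-cong (ap2 (wkT F) v0) p)

  ap2-ext : (F : Tm Γ s2) {f g : Tm Γ s1} →
            Pf Hs (all s0 (eq s0 (ap1 (wkT f) v0) (ap1 (wkT g) v0))) →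
            Pf Hs (eq s0 (ap2 F f) (ap2 F g))
  ap2-ext F {f} {g} p = ap2-cong F (⇒E (ax (ext1 f g)) p)

  ∃-vacuous-elim : ∀ {ψ} → Pf Hs (ex s0 (wkF ψ)) → Pf Hs ψ
  ∃-vacuous-elim p = ∃E p (hyp (here refl))

  ∃-vacuous-eq : ∀ {σ} {a b : Tm Γ σ} → Pf Hs (eq σ a b) → Pf Hs (ex s0 (eq σ (wkT a) (wkT b)))
  ∃-vacuous-eq {σ} {a} {b} p =
    ∃I zer (subst₂-Pf (eq σ) (sym (sub-single-wk zer a)) (sym (sub-single-wk zer b)) p)

module EqReasoning {Γ : Ctx} {Hs : List (Fm Γ)} {σ : Sort} where
  infix  3 _∎
  infixr 2 _≈⟨_⟩_

  _≈⟨_⟩_ : (a : Tm Γ σ) {b c : Tm Γ σ} → Pf Hs (eq σ a b) → Pf Hs (eq σ b c) → Pf Hs (eq σ a c)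
  _ ≈⟨ p ⟩ q = eq-trans p q

  _∎ : (a : Tm Γ σ) → Pf Hs (eq σ a a)
  _∎ = ≡refl

-- Explicit definitions.  The graph of t(x) is  ∃z (y = t(x)), with z and
-- y fresh: a Σ⁰₁ formula in the context y ∷ x ∷ Γ.

pad : ∀ {Γ σ} → Ren (σ ∷ Γ) (s0 ∷ s0 ∷ σ ∷ Γ)
pad v = there (there v)

graph : ∀ {Γ σ} → Tm (σ ∷ Γ) s0 → Fm (s0 ∷ σ ∷ Γ)
graph t = ex s0 (eq s0 v1 (renT pad t))

graph-Σ01 : ∀ {Γ σ} (t : Tm (σ ∷ Γ) s0) → IsΣ01 (graph t)
graph-Σ01 t = σ-ex (σ-eq _ _)

-- The graph at y := t(x) is  ∃z (t = t).
graph-witness : ∀ {Γ σ} (t : Tm (σ ∷ Γ) s0) → subT (liftS (single t)) (renT pad t) ≡ wkT t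
graph-witness t = trans (sub-ren _ (λ _ → refl) t) (sym (ren-as-sub there t))

-- The graph at another candidate y' is  ∃z (y' = t).
graph-candidate : ∀ {Γ σ} (t : Tm (σ ∷ Γ) s0) →
                  subT (liftS (liftS (single t))) (renT (liftR (liftR there)) (renT pad t)) ≡ wkT (wkT t)
graph-candidate t = begin
  subT (liftS (liftS (single t))) (renT (liftR (liftR there)) (renT pad t))
    ≡⟨ sub-ren _ (λ _ → refl) (renT pad t) ⟩
  subT _ (renT pad t)
    ≡⟨ sub-ren _ (λ _ → refl) t ⟩
  subT (λ v → var (there (there v))) t
    ≡⟨ sym (sub-ren _ (λ _ → refl) t) ⟩
  subT (λ v → var (there v)) (wkT t)
    ≡⟨ sym (ren-as-sub there (wkT t)) ⟩
  wkT (wkT t) ∎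
  where open ≡-Reasoning

-- The graph at y := f(x), as comprehension produces it, is  ∃z (f(x) = t(x)).
graph-at-application : ∀ {Γ σ τ} (fx : Tm (σ ∷ τ ∷ Γ) s0) (t : Tm (σ ∷ Γ) s0) →
                       subT (liftS (compSub fx)) (renT pad t) ≡ wkT (renT (liftR there) t)
graph-at-application fx t = begin
  subT (liftS (compSub fx)) (renT pad t)            ≡⟨ sub-ren _ pointwise t ⟩
  subT (λ v → var (there (liftR there v))) t        ≡⟨ sym (sub-ren _ (λ _ → refl) t) ⟩
  subT (λ v → var (there v)) (renT (liftR there) t) ≡⟨ sym (ren-as-sub there _) ⟩
  wkT (renT (liftR there) t)                        ∎
  where
  open ≡-Reasoning
  pointwise : ∀ {ρ} (v : _ ∋ ρ) → liftS (compSub fx) (pad v) ≡ var (there (liftR there v))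
  pointwise here      = refl
  pointwise (there v) = refl

-- Weakening under a binder and instantiating the new variable by its
-- neighbour is the identity: this is what ∀I followed by ∀E v0 (or ∃E
-- followed by ∃I v0) does to a term.
weaken-instantiate : ∀ {Δ α β γ} (u : Tm (α ∷ β ∷ Δ) γ) →
                     subT (liftS (single v0)) (renT (liftR (liftR there)) u) ≡ u
weaken-instantiate u = trans (sub-ren var pointwise u) (sub-id (λ _ → refl) u)
  where
  pointwise : ∀ {τ} (v : _ ∋ τ) → liftS (single v0) (liftR (liftR there) v) ≡ var v
  pointwise here              = refl
  pointwise (there here)      = refl
  pointwise (there (there v)) = refl

graph-functional : ∀ {Γ σ} {Hs : List (Fm Γ)} (t : Tm (σ ∷ Γ) s0) → Pf Hs (all σ (ex!0 (graph t)))
graph-functional t =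
  ∀I (∃I t (∧I
    (subst-Pf (λ x → ex s0 (eq s0 (wkT t) x)) (sym (graph-witness t)) (∃-vacuous-eq (≡refl t)))
    (∀I (⇒I (∃E (hyp (here refl)) (subst-Pf (eq s0 v1) (graph-candidate t) (hyp (here refl))))))))

data FunSort : Sort → Sort → Set where
  real       : FunSort s0 s1
  functional : FunSort s1 s2

apply : ∀ {Γ σ τ} → FunSort σ τ → Tm Γ τ → Tm Γ σ → Tm Γ s0
apply real       = ap1
apply functional = ap2

comprehension : ∀ {Γ σ τ} {Hs : List (Fm Γ)} (k : FunSort σ τ) (φ : Fm (s0 ∷ σ ∷ Γ)) → IsΣ01 φ →
                Pf Hs (all σ (ex!0 φ)) → Pf Hs (ex τ (all σ (subF (compSub (apply k v1 v0)) φ)))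
comprehension real       φ h = ⇒E (ax (comp1 φ h))
comprehension functional φ h = ⇒E (ax (comp2 φ h))

define : ∀ {Γ σ τ} {Hs : List (Fm Γ)} (k : FunSort σ τ) (t : Tm (σ ∷ Γ) s0) →
         Pf Hs (ex τ (all σ (eq s0 (apply k v1 v0) (renT (liftR there) t))))
define k t =
  ∃E (comprehension k (graph t) (graph-Σ01 t) (graph-functional t))
    (∃I v0 (subst₂-Pf (λ x y → all _ (eq s0 x y))
              (sym (weaken-instantiate fx)) (sym (weaken-instantiate (renT (liftR there) t)))
      (∀I (∃-vacuous-elim
        (subst₂-Pf (λ x y → ex s0 (eq s0 x y))
           (weaken-instantiate (wkT fx)) (trans (weaken-instantiate _) (graph-at-application fx t))
           (∀E (hyp (here refl)) v0))))))
  where fx = apply k v1 v0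

open EqReasoning

constant-tail : ∀ {Γ} {Hs : List (Fm Γ)} (C : Tm Γ s2) (n : Tm Γ s0) (r : Tm Γ s1) (k : Tm Γ s0) →
                (∀ u → Pf Hs (eq s0 (ap2 C u) (ap1 u (zer ⊕ one)))) →
                Pf Hs (eq s0 (ap1 (star C (cons n r)) k) n)
constant-tail C n r k C-def =
  ap1 (star C (cons n r)) k            ≈⟨ ax (star-def C (cons n r) k) ⟩
  ap2 C (cons k (cons n r))            ≈⟨ C-def (cons k (cons n r)) ⟩
  ap1 (cons k (cons n r)) (zer ⊕ one)  ≈⟨ ax (cons-suc k (cons n r) zer) ⟩
  ap1 (cons n r) zer                   ≈⟨ ax (cons-0 n r) ⟩
  n                                    ∎

even-entries : ∀ {Γ} {Hs : List (Fm Γ)} (X : Tm Γ s2) (s : Tm Γ s1) (n : Tm Γ s0) →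
               (∀ u → Pf Hs (eq s0 (ap2 X u) (ap1 u (two ⊗ ap1 u zer ⊕ one)))) →
               Pf Hs (eq s0 (ap1 (star X s) n) (ap1 s (two ⊗ n)))
even-entries X s n X-def =
  ap1 (star X s) n                                 ≈⟨ ax (star-def X s n) ⟩
  ap2 X (cons n s)                                 ≈⟨ X-def (cons n s) ⟩
  ap1 (cons n s) (two ⊗ ap1 (cons n s) zer ⊕ one)  ≈⟨ ap1-cong (cons n s) (eq-cong (two ⊗ v0 ⊕ one) (ax (cons-0 n s))) ⟩
  ap1 (cons n s) (two ⊗ n ⊕ one)                   ≈⟨ ax (cons-suc n s (two ⊗ n)) ⟩
  ap1 s (two ⊗ n)                                  ∎

v4 : ∀ {Γ σ τ₁ τ₂ τ₃ τ₄} → Tm (τ₄ ∷ τ₃ ∷ τ₂ ∷ τ₁ ∷ σ ∷ Γ) σ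
v4 = var (there (there (there (there here))))

v5 : ∀ {Γ σ τ₁ τ₂ τ₃ τ₄ τ₅} → Tm (τ₅ ∷ τ₄ ∷ τ₃ ∷ τ₂ ∷ τ₁ ∷ σ ∷ Γ) σ
v5 = var (there (there (there (there (there here)))))

-- (1) Given F, define C(u) = u(1), an arbitrary real Z (here Z(n) = 0) and
-- r(n) = F(C * (n ⌢ Z)).  Innermost context: n, s, r, Z, C, F; the
-- hypotheses are ∀k s(k) = n and the definitions of r, Z, C.
constant-sequences : RCA03⊢ stmt1
constant-sequences =
  ∀I (∃E (define functional (ap1 v0 (zer ⊕ one)))
     (∃E (define real zer)
     (∃E (define real (ap2 v3 (star v2 (cons v0 v1))))
     (∃I v0 (∀I (∀I (⇒I
       (ap1 v2 v0                      ≈⟨ ∀E (hyp (there (here refl))) v0 ⟩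
        ap2 v5 (star v4 (cons v0 v3))  ≈⟨ ap2-ext v5 (∀I (eq-trans
              (constant-tail v5 v1 v4 v0 (∀E (hyp (there (there (there (here refl)))))))
              (eq-sym (∀E (hyp (here refl)) v0)))) ⟩
        ap2 v5 v1                      ∎))))))))

-- (2) Given F, define X(u) = u(2·u(0)+1) and G(u) = F(X * u).  Innermost
-- context: t, s, G, X, F; the hypotheses are ∀n t(n) = s(2n) and the
-- definitions of G, X.
even-subsequences : RCA03⊢ stmt2
even-subsequences =
  ∀I (∃E (define functional (ap1 v0 (two ⊗ ap1 v0 zer ⊕ one)))
     (∃E (define functional (ap2 v2 (star v1 v0)))
     (∃I v0 (∀I (∀I (⇒I
       (ap2 v2 v1            ≈⟨ ∀E (hyp (there (here refl))) v1 ⟩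
        ap2 v4 (star v3 v1)  ≈⟨ ap2-ext v4 (∀I (eq-trans
              (even-entries v4 v2 v0 (∀E (hyp (there (there (here refl))))))
              (eq-sym (∀E (hyp (here refl)) v0)))) ⟩
        ap2 v4 v0            ∎)))))))

fact2p4 : RCA03⊢ stmt1 × RCA03⊢ stmt2
fact2p4 = constant-sequences , even-subsequences
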